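{- There is an infinite family of connected graphs such that for every graph $G=(V,E)$ in the family and $p=|V|$ robots, every set $F$ of new edges (between vertices of $V$, not already in $E$) for which $G+F$ is universally solvable for $p$ robots satisfies $|F|\ge \frac{|V|-1}{2}=\frac{p-1}{2}$.
   Context: Robots are $R=[p]$; a configuration on a graph $H=(V,E')$ is an injective map $S:R\to V$. A pair $(S,S')$ of configurations is a valid move if it is one of: (i) a simple path move: there is a simple path $(u_0,\dots,u_k)$ in $H$ with $u_k\notin S(R)$, $u_0\notin S'(R)$, $S'(i)=S(i)$ for robots not on the path, and $S'(i)=u_{j+1}$ whenever $S(i)=u_j$, $0\le j\le k-1$; (ii) a simple rotation move: there is a simple cycle $(u_0,\dots,u_{k-1},u_k=u_0)$ in $H$ all of whose vertices are occupied in $S$ and in $S'$, robots off the cycle stay fixed, and $S'(i)=u_{j+1}$ whenever $S(i)=u_j$; (iii) a dummy move $(S,S)$. $T$ is reachable from $S$ if there is a finite sequence $S=S_0,\dots,S_t=T$ with each $(S_{k-1},S_k)$ a valid move. $H$ is universally solvable for $p$ robots if every configuration is reachable from every other. -}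

module Defs where

open import Data.Nat using (ℕ; zero; suc; _+_; _*_; _∸_; _≤_)
open import Data.Fin using (Fin; zero; suc; inject₁; fromℕ)
open import Data.Bool using (Bool; true; false)
open import Data.List using (List; length)
open import Data.List.Membership.Propositional using (_∈_)
open import Data.List.Relation.Unary.All using (All)
open import Data.List.Relation.Unary.AllPairs using (AllPairs)
open import Data.Product using (Σ; _×_; _,_; ∃; proj₁)
open import Data.Sum using (_⊎_)
open import Relation.Nullary using (¬_)
open import Relation.Binary.PropositionalEquality using (_≡_; _≢_)
open import Relation.Binary.Construct.Closure.ReflexiveTransitive using (Star)
open import Function.Definitions using (Injective)

record Graph (n : ℕ) : Set where
  field
    adj     : Fin n → Fin n → Bool
    adj-sym : ∀ u v → adj u v ≡ adj v u
    adj-irr : ∀ u → adj u u ≡ false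
open Graph public

Edge : ∀ {n} → Graph n → Fin n → Fin n → Set
Edge G u v = adj G u v ≡ true

Connected : ∀ {n} → Graph n → Set
Connected {n} G = ∀ (u v : Fin n) → Star (Edge G) u v

SameEdge : ∀ {n} → Fin n × Fin n → Fin n × Fin n → Set
SameEdge (a , b) (c , d) = ((a ≡ c) × (b ≡ d)) ⊎ ((a ≡ d) × (b ≡ c))

NewEdge : ∀ {n} → Graph n → Fin n × Fin n → Set
NewEdge G (u , v) = (u ≢ v) × ¬ Edge G u v

-- F is a set of new edges of G: every element is a new edge, and no
-- undirected edge is listed twice (so |F| = length F)
NewEdgeSet : ∀ {n} → Graph n → List (Fin n × Fin n) → Set
NewEdgeSet G F = All (NewEdge G) F × AllPairs (λ e e' → ¬ SameEdge e e') F

EdgePlus : ∀ {n} → Graph n → List (Fin n × Fin n) → Fin n → Fin n → Set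
EdgePlus G F u v = Edge G u v ⊎ ((u , v) ∈ F ⊎ (v , u) ∈ F)

module Motion {n : ℕ} (H : Fin n → Fin n → Set) (p : ℕ) where

  Config : Set
  Config = Σ (Fin p → Fin n) (Injective _≡_ _≡_)

  conf : Config → Fin p → Fin n
  conf = proj₁

  PathMove : Config → Config → Set
  PathMove S S' =
    Σ ℕ λ k → Σ (Fin (suc k) → Fin n) λ u →
      Injective _≡_ _≡_ u
    × (∀ (j : Fin k) → H (u (inject₁ j)) (u (suc j)))
    × (∀ i → conf S i ≢ u (fromℕ k))
    × (∀ i → conf S' i ≢ u zero)
    × (∀ i → (∀ j → conf S i ≢ u j) → conf S' i ≡ conf S i)
    × (∀ i (j : Fin k) → conf S i ≡ u (inject₁ j) → conf S' i ≡ u (suc j))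

  -- (ii) simple rotation move along the simple cycle
  --      u 0 , … , u k , u 0   (k ≥ 2, i.e. at least 3 vertices)
  RotationMove : Config → Config → Set
  RotationMove S S' =
    Σ ℕ λ k → Σ (Fin (suc k) → Fin n) λ u →
      (2 ≤ k)
    × Injective _≡_ _≡_ u
    × (∀ (j : Fin k) → H (u (inject₁ j)) (u (suc j)))
    × H (u (fromℕ k)) (u zero)
    × (∀ j → ∃ λ i → conf S i ≡ u j)
    × (∀ j → ∃ λ i → conf S' i ≡ u j)
    × (∀ i → (∀ j → conf S i ≢ u j) → conf S' i ≡ conf S i)
    × (∀ i (j : Fin k) → conf S i ≡ u (inject₁ j) → conf S' i ≡ u (suc j))
    × (∀ i → conf S i ≡ u (fromℕ k) → conf S' i ≡ u zero)

  DummyMove : Config → Config → Set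
  DummyMove S S' = ∀ i → conf S' i ≡ conf S i

  ValidMove : Config → Config → Set
  ValidMove S S' = PathMove S S' ⊎ (RotationMove S S' ⊎ DummyMove S S')

  Reachable : Config → Config → Set
  Reachable = Star ValidMove

  UniversallySolvable : Set
  UniversallySolvable = ∀ (S T : Config) → Reachable S T

UniversallySolvable : ∀ {n} → (Fin n → Fin n → Set) → ℕ → Set
UniversallySolvable H p = Motion.UniversallySolvable H p

{-# OPTIONS --safe #-}
-- Take the star K₁,N. With as many robots as vertices no vertex is ever
-- empty, so no path move is possible and robots only move by rotations
-- along simple cycles. A leaf that is not an endpoint of a new edge still
-- has the centre as its only neighbour, hence lies on no cycle, and its
-- robot can never leave it. So a solvable G + F covers all N leaves by
-- endpoints of F, giving N ≤ 2|F|.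
module Submission where

open import Defs
open import Data.Nat using (ℕ; suc; s≤s; _≤_; _∸_; _*_)
open import Data.Nat.Properties using (n≤1+n; 1+n≰n; *-suc)
open import Data.Fin using (Fin; zero; suc; inject₁; fromℕ; punchOut)
open import Data.Fin.Properties using (_≟_; any?; suc-injective; injective⇒≤; punchOut-injective)
open import Data.Fin.Relation.Unary.Top using (view; ‵fromℕ; ‵inject₁)
open import Data.Fin.Permutation as Perm using (Permutation; _⟨$⟩ʳ_)
import Data.Fin.Permutation.Components as Components
open import Data.Bool using (Bool; true; false)
open import Data.List using (List; []; _∷_; length; lookup)
open import Data.List.Membership.Propositional using (_∈_; _∉_)
import Data.List.Membership.DecPropositional as DecMembership
open import Data.List.Relation.Unary.Any using (here; there; index)
open import Data.List.Relation.Unary.Any.Properties using (lookup-index)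
open import Data.Product using (Σ; _×_; _,_; ∃; ∃₂)
open import Data.Sum using (_⊎_; inj₁; inj₂; swap)
open import Data.Empty using (⊥-elim)
open import Relation.Nullary using (¬_; yes; no)
open import Relation.Nullary.Decidable using (dec-true; decidable-stable)
open import Relation.Binary.PropositionalEquality
  using (_≡_; _≢_; refl; sym; trans; cong; subst; module ≡-Reasoning)
open import Relation.Binary.Construct.Closure.ReflexiveTransitive using (Star; ε; _◅_; _◅◅_)
open import Function.Definitions using (Injective)
open import Function.Bundles using (Injection)
open import Function.Properties.Inverse using (↔⇒↣)

injective⇒surjective : ∀ {n} {f : Fin n → Fin n} → Injective _≡_ _≡_ f →
                       ∀ y → ∃ λ x → f x ≡ y
injective⇒surjective {suc n} {f} f-inj y with any? (λ x → f x ≟ y)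
... | yes hit = hit
... | no miss = ⊥-elim (1+n≰n (injective⇒≤ punchOut∘f-injective))
  where
  avoids : ∀ x → y ≢ f x
  avoids x y≡fx = miss (x , sym y≡fx)
  punchOut∘f-injective : Injective _≡_ _≡_ (λ x → punchOut (avoids x))
  punchOut∘f-injective eq = f-inj (punchOut-injective (avoids _) (avoids _) eq)

injective-into-list⇒≤-length : ∀ {A : Set} {m} {f : Fin m → A} (L : List A) →
                               Injective _≡_ _≡_ f → (∀ i → f i ∈ L) → m ≤ length L
injective-into-list⇒≤-length {f = f} L f-inj f∈L = injective⇒≤ position-injective
  where
  open ≡-Reasoning
  position-injective : Injective _≡_ _≡_ (λ i → index (f∈L i))
  position-injective {i} {j} same-position = f-inj (begin
    f i                         ≡⟨ lookup-index (f∈L i) ⟩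
    lookup L (index (f∈L i))    ≡⟨ cong (lookup L) same-position ⟩
    lookup L (index (f∈L j))    ≡⟨ lookup-index (f∈L j) ⟨
    f j                         ∎)

transpose-sendsˡ : ∀ {n} (i j : Fin n) → Components.transpose i j i ≡ j
transpose-sendsˡ i j rewrite dec-true (i ≟ i) refl = refl

suc²≢inject₁² : ∀ {n} (i : Fin n) → suc (suc i) ≢ inject₁ (inject₁ i)
suc²≢inject₁² (suc i) eq = suc²≢inject₁² i (suc-injective eq)

data CycleStep {k : ℕ} : Fin (suc k) → Fin (suc k) → Set where
  forward : (j : Fin k) → CycleStep (inject₁ j) (suc j)
  close   : CycleStep (fromℕ k) zero

cycle-neighbours : ∀ {k} → 2 ≤ k → (j : Fin (suc k)) →
                   ∃₂ λ a b → a ≢ b × CycleStep j a × CycleStep b j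
cycle-neighbours {suc (suc m)} (s≤s (s≤s _)) zero =
  suc zero , fromℕ (suc (suc m)) , (λ ()) , forward zero , close
cycle-neighbours {suc (suc m)} (s≤s (s≤s _)) (suc j) with view j
... | ‵fromℕ =
  zero , inject₁ (fromℕ (suc m)) , (λ ()) , close , forward (fromℕ (suc m))
... | ‵inject₁ i =
  suc (suc i) , inject₁ (inject₁ i) , suc²≢inject₁² i , forward (suc i) , forward (inject₁ i)

Pendant : ∀ {n} → (Fin n → Fin n → Set) → Fin n → Fin n → Set
Pendant H v c = ∀ w → H v w ⊎ H w v → w ≡ c

module _ {n} (H : Fin n → Fin n → Set) where

  cycle-vertex-not-pendant : ∀ {k} {u : Fin (suc k) → Fin n} → 2 ≤ k →
                             Injective _≡_ _≡_ u →
                             (∀ {a b} → CycleStep a b → H (u a) (u b)) →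
                             ∀ j c → ¬ Pendant H (u j) c
  cycle-vertex-not-pendant 2≤k u-inj edge j c pendant
    with a , b , a≢b , j→a , b→j ← cycle-neighbours 2≤k j =
    a≢b (u-inj (trans (pendant _ (inj₁ (edge j→a))) (sym (pendant _ (inj₂ (edge b→j))))))

  open Motion H n hiding (UniversallySolvable)

  occupied : (S : Config) → ∀ v → ∃ λ r → conf S r ≡ v
  occupied (_ , S-inj) = injective⇒surjective S-inj

  no-path-move : ∀ {S S'} → ¬ PathMove S S'
  no-path-move {S} (k , u , _ , _ , end-free , _)
    with r , r-at-end ← occupied S (u (fromℕ k)) = end-free r r-at-end

  pendant-robot-stays : ∀ {v c S S'} r → Pendant H v c → ValidMove S S' →
                        conf S r ≡ v → conf S' r ≡ v
  pendant-robot-stays {S = S} {S'} r pendant (inj₁ path) _ =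
    ⊥-elim (no-path-move {S} {S'} path)
  pendant-robot-stays {v} r pendant
    (inj₂ (inj₁ (k , u , 2≤k , u-inj , fwd , cls , _ , _ , off-fixed , _))) r-at-v
    with any? (λ j → u j ≟ v)
  ... | yes (j , refl) = ⊥-elim (cycle-vertex-not-pendant 2≤k u-inj edge j _ pendant)
    where
    edge : ∀ {a b} → CycleStep a b → H (u a) (u b)
    edge (forward j) = fwd j
    edge close       = cls
  ... | no off-cycle =
    trans (off-fixed r (λ j r-at-uj → off-cycle (j , trans (sym r-at-uj) r-at-v))) r-at-v
  pendant-robot-stays r pendant (inj₂ (inj₂ dummy)) r-at-v = trans (dummy r) r-at-v

  pendant-robot-stuck : ∀ {v c S T} r → Pendant H v c → Reachable S T →
                        conf S r ≡ v → conf T r ≡ v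
  pendant-robot-stuck r pendant ε r-at-v = r-at-v
  pendant-robot-stuck {S = S} r pendant (_◅_ {j = S'} move moves) r-at-v =
    pendant-robot-stuck r pendant moves (pendant-robot-stays {S = S} {S'} r pendant move r-at-v)

  permutationConfig : Permutation n n → Config
  permutationConfig π = (π ⟨$⟩ʳ_) , Injection.injective (↔⇒↣ π)

  pendant⇒¬solvable : ∀ {v c} → Pendant H v c → v ≢ c → ¬ UniversallySolvable H n
  pendant⇒¬solvable {v} {c} pendant v≢c solvable = v≢c (begin
    v                          ≡⟨ pendant-robot-stuck v pendant (solvable identity swapped) refl ⟨
    Components.transpose v c v ≡⟨ transpose-sendsˡ v c ⟩
    c                          ∎)
    where
    open ≡-Reasoning
    identity swapped : Config
    identity = permutationConfig Perm.id
    swapped  = permutationConfig (Perm.transpose v c)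

starAdj : ∀ {m} → Fin (suc m) → Fin (suc m) → Bool
starAdj zero    zero    = false
starAdj zero    (suc _) = true
starAdj (suc _) zero    = true
starAdj (suc _) (suc _) = false

star : ∀ m → Graph (suc m)
star m = record { adj = starAdj ; adj-sym = sym-starAdj ; adj-irr = irr-starAdj }
  where
  sym-starAdj : ∀ u v → starAdj u v ≡ starAdj v u
  sym-starAdj zero    zero    = refl
  sym-starAdj zero    (suc _) = refl
  sym-starAdj (suc _) zero    = refl
  sym-starAdj (suc _) (suc _) = refl
  irr-starAdj : ∀ u → starAdj u u ≡ false
  irr-starAdj zero    = refl
  irr-starAdj (suc _) = refl

star-connected : ∀ m → Connected (star m)
star-connected m u v = to-centre u ◅◅ from-centre v
  where
  to-centre : ∀ u → Star (Edge (star m)) u zero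
  to-centre zero    = ε
  to-centre (suc _) = refl ◅ ε
  from-centre : ∀ v → Star (Edge (star m)) zero v
  from-centre zero    = ε
  from-centre (suc _) = refl ◅ ε

endpoints : ∀ {A : Set} → List (A × A) → List A
endpoints []            = []
endpoints ((a , b) ∷ F) = a ∷ b ∷ endpoints F

length-endpoints : ∀ {A : Set} (F : List (A × A)) → length (endpoints F) ≡ 2 * length F
length-endpoints []      = refl
length-endpoints (_ ∷ F) =
  trans (cong (λ l → suc (suc l)) (length-endpoints F)) (sym (*-suc 2 (length F)))

∈-endpoints : ∀ {A : Set} {a b : A} {F} → (a , b) ∈ F ⊎ (b , a) ∈ F → a ∈ endpoints F
∈-endpoints                   (inj₁ (here refl)) = here refl
∈-endpoints                   (inj₂ (here refl)) = there (here refl)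
∈-endpoints {F = (_ , _) ∷ _} (inj₁ (there e))   = there (there (∈-endpoints (inj₁ e)))
∈-endpoints {F = (_ , _) ∷ _} (inj₂ (there e))   = there (there (∈-endpoints (inj₂ e)))

leaf-pendant : ∀ {m} F (i : Fin m) → suc i ∉ endpoints F →
               Pendant (EdgePlus (star m) F) (suc i) zero
leaf-pendant F i uncovered zero    _                  = refl
leaf-pendant F i uncovered (suc _) (inj₁ (inj₁ ()))
leaf-pendant F i uncovered (suc _) (inj₂ (inj₁ ()))
leaf-pendant F i uncovered _       (inj₁ (inj₂ e))    = ⊥-elim (uncovered (∈-endpoints e))
leaf-pendant F i uncovered _       (inj₂ (inj₂ e))    = ⊥-elim (uncovered (∈-endpoints (swap e)))

leaves-covered : ∀ {m} F → UniversallySolvable (EdgePlus (star m) F) (suc m) →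
                 ∀ (i : Fin m) → suc i ∈ endpoints F
leaves-covered F solvable i =
  decidable-stable (DecMembership._∈?_ _≟_ (suc i) (endpoints F)) λ uncovered →
    pendant⇒¬solvable (EdgePlus (star _) F) (leaf-pendant F i uncovered) (λ ()) solvable

solvable-star-bound : ∀ {m} F → UniversallySolvable (EdgePlus (star m) F) (suc m) →
                      m ≤ 2 * length F
solvable-star-bound F solvable =
  subst (_ ≤_) (length-endpoints F)
    (injective-into-list⇒≤-length (endpoints F) suc-injective (leaves-covered F solvable))

theorem27 : ∀ (N : ℕ) → Σ ℕ λ n → (N ≤ n) × Σ (Graph n) λ G →
    Connected G
    × (∀ (F : List (Fin n × Fin n)) → NewEdgeSet G F
    → UniversallySolvable (EdgePlus G F) n
    → n ∸ 1 ≤ 2 * length F)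
theorem27 N = suc N , n≤1+n N , star N , star-connected N , λ F _ → solvable-star-bound F
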